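{- For integers $n\ge1$ and $0\le k\le n$, every NUOBDD computing $\mathtt{EXACT}^k_n$ has width at least $\max\{k+1,n-k+1\}$.
   Context: $\mathtt{EXACT}^k_n:\{0,1\}^n\to\{0,1\}$ is $1$ iff the input contains exactly $k$ ones. A unitary OBDD (UOBDD) of width $d$ on $n$ variables is $(Q,|\psi^0\rangle,T,Q_{acc})$: $Q=\{q_1,\dots,q_d\}$ indexes an orthonormal basis of $\mathbb{C}^d$, $|\psi^0\rangle$ a unit vector, $Q_{acc}\subseteq Q$, $T=((i_j,U_j(0),U_j(1)))_{j=1}^n$ with $(i_1,\dots,i_n)$ a permutation of $\{1,\dots,n\}$ and $U_j(b)$ unitary $d\times d$ matrices. On input $\sigma$ the final state is $|\psi^n\rangle=U_n(\sigma_{i_n})\cdots U_1(\sigma_{i_1})|\psi^0\rangle$ and the acceptance probability is $\|P_{acc}|\psi^n\rangle\|^2$ with $P_{acc}$ the projection onto the span of accepting basis states. An NUOBDD (nondeterministic UOBDD) computes $f$ if for all $\sigma$: $f(\sigma)=1$ iff the acceptance probability is nonzero. Its width is $d$. -}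

module Defs where

open import Level using (Level; _⊔_) renaming (suc to lsuc)
open import Algebra.Bundles using (CommutativeRing)
open import Data.Nat using (ℕ; zero; suc)
open import Data.Fin using (Fin; zero; suc; toℕ)
open import Data.Fin.Permutation using (Permutation′; _⟨$⟩ʳ_)
open import Data.Bool using (Bool; true; false; if_then_else_)
open import Data.Product using (∃; _×_)
open import Relation.Nullary using (¬_; does)
open import Relation.Binary.PropositionalEquality using (_≡_)

sumFin : ∀ {a} {A : Set a} → (A → A → A) → A → (m : ℕ) → (Fin m → A) → A
sumFin _+_ z zero    f = z
sumFin _+_ z (suc m) f = f zero + sumFin _+_ z m (λ i → f (suc i))

module RingOps {c ℓ} (R : CommutativeRing c ℓ) where
  open CommutativeRing R using (Carrier; _+_; _*_; 0#; 1#)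

  pow : Carrier → ℕ → Carrier
  pow x zero    = 1#
  pow x (suc m) = x * pow x m

  Σ : (m : ℕ) → (Fin m → Carrier) → Carrier
  Σ = sumFin _+_ 0#

-- By Artin–Schreier the
-- fixed field is real closed and K = F(i), so (K, conj) is elementarily
-- equivalent to (ℂ, complex conjugation); ℂ is the intended model.
record ConjField (c ℓ : Level) : Set (lsuc (c ⊔ ℓ)) where
  field
    commRing : CommutativeRing c ℓ
  open CommutativeRing commRing public
  open RingOps commRing public

  field
    1≉0       : ¬ (1# ≈ 0#)
    inverse   : ∀ x → ¬ (x ≈ 0#) → ∃ λ y → x * y ≈ 1#
    algClosed : ∀ m (a : Fin (suc m) → Carrier) →
                ∃ λ x → pow x (suc m) + Σ (suc m) (λ i → a i * pow x (toℕ i)) ≈ 0#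
    conj          : Carrier → Carrier
    conj-cong     : ∀ {x y} → x ≈ y → conj x ≈ conj y
    conj-+        : ∀ x y → conj (x + y) ≈ conj x + conj y
    conj-*        : ∀ x y → conj (x * y) ≈ conj x * conj y
    conj-1        : conj 1# ≈ 1#
    conj-involutive : ∀ x → conj (conj x) ≈ x
    conj-nontrivial : ∃ λ x → ¬ (conj x ≈ x)

module _ {c ℓ} (K : ConjField c ℓ) where
  open ConjField K using (Carrier; _≈_; _+_; _*_; 0#; 1#; conj; Σ)

  Vector : ℕ → Set c
  Vector d = Fin d → Carrier

  Matrix : ℕ → Set c
  Matrix d = Fin d → Fin d → Carrier

  δ : ∀ {d} → Fin d → Fin d → Carrier
  δ i j = if does (i Data.Fin.≟ j) then 1# else 0#

  _·_ : ∀ {d} → Matrix d → Vector d → Vector d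
  _·_ {d} M v i = Σ d (λ j → M i j * v j)

  IsUnitary : ∀ {d} → Matrix d → Set ℓ
  IsUnitary {d} U =
    (∀ i j → Σ d (λ l → conj (U l i) * U l j) ≈ δ i j) ×
    (∀ i j → Σ d (λ l → U i l * conj (U j l)) ≈ δ i j)

  normSq : ∀ {d} → Vector d → Carrier
  normSq {d} v = Σ d (λ i → conj (v i) * v i)

  record UOBDD (n d : ℕ) : Set (c ⊔ ℓ) where
    field
      ψ₀      : Vector d
      ψ₀-unit : normSq ψ₀ ≈ 1#
      accepting : Fin d → Bool
      order   : Permutation′ n
      U       : Fin n → Bool → Matrix d
      U-unitary : ∀ j b → IsUnitary (U j b)

    private
      run : (m : ℕ) → (Fin m → Vector d → Vector d) → Vector d → Vector d
      run zero    f v = v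
      run (suc m) f v = run m (λ j → f (suc j)) (f zero v)

    finalState : (Fin n → Bool) → Vector d
    finalState σ = run n (λ j v → U j (σ (order ⟨$⟩ʳ j)) · v) ψ₀

    accProb : (Fin n → Bool) → Carrier
    accProb σ = Σ d (λ q → if accepting q
                             then conj (finalState σ q) * finalState σ q
                             else 0#)

  NComputes : ∀ {n d} → UOBDD n d → ((Fin n → Bool) → Bool) → Set ℓ
  NComputes B f = ∀ σ → (f σ ≡ true → ¬ (UOBDD.accProb B σ ≈ 0#))
                      × (¬ (UOBDD.accProb B σ ≈ 0#) → f σ ≡ true)

countOnes : ∀ {n} → (Fin n → Bool) → ℕ
countOnes {zero}  σ = 0
countOnes {suc n} σ = (if σ zero then 1 else 0) Data.Nat.+ countOnes (λ i → σ (suc i))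

EXACT : (n k : ℕ) → (Fin n → Bool) → Bool
EXACT n k σ = does (countOnes σ Data.Nat.≟ k)

-- Let ψ₀ be the initial state and Uⱼ(b) the step matrices (indexed in reading order). The
-- probe vector tⱼ = U₀(0)† ⋯ U_{j-1}(0)† U_{j-1}(1) ⋯ U₀(1) ψ₀ is such that reading j zeros
-- from tⱼ gives the state reached from ψ₀ after reading j ones. So running the input
-- 0ⁱ 1^(k-i) 0^(n-k) from tⱼ, for j ≤ i ≤ k, gives the state after an input with k - i + j ones,
-- whose accepted part vanishes for j < i and not for j = i. The k + 1 probes t₀, …, t_k are
-- therefore linearly independent and d ≥ k + 1; flipping every input bit gives d ≥ n - k + 1.
--
-- Over the abstract field K, "acceptance probability 0 iff the accepted amplitudes vanish"
-- needs the fixed field of conj to be formally real. This follows from the existence of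
-- i = √-1 with conj i = -i and from char K ≠ 2, the latter by an Artin–Schreier argument.
-- Equality in K is not decidable, so case distinctions are made under double negation;
-- this is harmless as the conclusion is an inequality between natural numbers.
module Submission where

open import Algebra.Bundles using (CommutativeRing)
open import Algebra.Solver.Ring.AlmostCommutativeRing using (_-Raw-AlmostCommutative⟶_; fromCommutativeRing)
import Algebra.Properties.CommutativeMonoid.Sum as CommutativeMonoidSum
open import Data.Bool using (Bool; true; false; not; if_then_else_)
open import Data.Bool.Properties using (T-≡)
open import Data.Empty using (⊥; ⊥-elim)
open import Data.Fin as Fin using (Fin; zero; suc; toℕ)
import Data.Fin.Properties as Finₚ
import Data.Fin.Permutation as Perm
open import Data.Fin.Permutation using (Permutation′; _⟨$⟩ʳ_; _⟨$⟩ˡ_)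
open import Data.Integer as ℤ using (ℤ; +_; -[1+_]; _⊖_)
import Data.Integer.Properties as ℤ
open import Data.Maybe using (Maybe; just; nothing)
open import Data.Nat as ℕ using (ℕ; zero; suc; _≤_; z≤n; s≤s)
import Data.Nat.Properties as ℕ
open import Data.Product using (∃; _×_; _,_; proj₁; proj₂)
open import Data.Sign as Sign using (Sign)
open import Data.Vec.Functional using (_∷_; insertAt; removeAt)
import Data.Vec.Functional.Properties as Vecₚ
open import Function using (_∘_; id)
open import Function.Bundles using (Equivalence)
import Level
open import Relation.Binary.PropositionalEquality as ≡ using (_≡_; _≗_)
open import Relation.Nullary using (¬_; yes; no)
open import Relation.Nullary.Decidable using (decidable-stable)
open import Relation.Nullary.Negation using (contradiction; contraposition)

open import Defs

-- The ring solver for a commutative ring whose equality is not decidable: coefficients are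
-- normalised in ℤ instead.
module ℤ-CoefficientSolver {c ℓ} (R : CommutativeRing c ℓ) where
  open CommutativeRing R hiding (zero)
  open import Algebra.Properties.Ring ring
    using (-‿distribˡ-*; -‿distribʳ-*; -‿involutive; -0#≈0#; -‿+-comm)
  open import Algebra.Properties.CommutativeSemigroup +-commutativeSemigroup using (interchange)
  open import Algebra.Properties.Semiring.Mult.TCOptimised semiring
    using (1+×; ×-homo-+; ×1-homo-*) renaming (_×_ to _×ᵣ_)
  open import Relation.Binary.Reasoning.Setoid setoid

  signed : Sign → Carrier → Carrier
  signed Sign.+ x = x
  signed Sign.- x = - x

  fromℤ : ℤ → Carrier
  fromℤ (+ n)      = n ×ᵣ 1#
  fromℤ (-[1+ n ]) = - (suc n ×ᵣ 1#)

  fromℤ-◃ : ∀ s n → fromℤ (s ℤ.◃ n) ≈ signed s (n ×ᵣ 1#)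
  fromℤ-◃ Sign.+ zero    = refl
  fromℤ-◃ Sign.- zero    = sym -0#≈0#
  fromℤ-◃ Sign.+ (suc n) = refl
  fromℤ-◃ Sign.- (suc n) = refl

  fromℤ-⊖ : ∀ m n → fromℤ (m ⊖ n) ≈ m ×ᵣ 1# - n ×ᵣ 1#
  fromℤ-⊖ m zero = begin
    fromℤ (m ⊖ zero)  ≡⟨ ≡.cong fromℤ (ℤ.⊖-≥ {m} z≤n) ⟩
    m ×ᵣ 1#           ≈⟨ sym (+-identityʳ _) ⟩
    m ×ᵣ 1# + 0#      ≈⟨ +-congˡ (sym -0#≈0#) ⟩
    m ×ᵣ 1# - 0#      ∎
  fromℤ-⊖ zero (suc n) = begin
    fromℤ (zero ⊖ suc n)  ≡⟨ ≡.cong fromℤ (ℤ.⊖-< {zero} {suc n} (s≤s z≤n)) ⟩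
    - (suc n ×ᵣ 1#)       ≈⟨ sym (+-identityˡ _) ⟩
    0# - suc n ×ᵣ 1#      ∎
  fromℤ-⊖ (suc m) (suc n) = begin
    fromℤ (suc m ⊖ suc n)              ≡⟨ ≡.cong fromℤ (ℤ.[1+m]⊖[1+n]≡m⊖n m n) ⟩
    fromℤ (m ⊖ n)                      ≈⟨ fromℤ-⊖ m n ⟩
    m ×ᵣ 1# - n ×ᵣ 1#                  ≈⟨ sym (+-identityˡ _) ⟩
    0# + (m ×ᵣ 1# - n ×ᵣ 1#)           ≈⟨ +-congʳ (sym (-‿inverseʳ 1#)) ⟩
    (1# - 1#) + (m ×ᵣ 1# - n ×ᵣ 1#)    ≈⟨ interchange 1# (- 1#) (m ×ᵣ 1#) (- (n ×ᵣ 1#)) ⟩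
    (1# + m ×ᵣ 1#) + (- 1# - n ×ᵣ 1#)  ≈⟨ +-cong (sym (1+× m 1#)) (trans (-‿+-comm 1# _) (-‿cong (sym (1+× n 1#)))) ⟩
    suc m ×ᵣ 1# - suc n ×ᵣ 1#          ∎

  fromℤ-+ : ∀ i j → fromℤ (i ℤ.+ j) ≈ fromℤ i + fromℤ j
  fromℤ-+ -[1+ m ] -[1+ n ] = begin
    - (suc (suc (m ℕ.+ n)) ×ᵣ 1#)      ≡⟨ ≡.cong (λ k → - (k ×ᵣ 1#)) (≡.sym (ℕ.+-suc (suc m) n)) ⟩
    - ((suc m ℕ.+ suc n) ×ᵣ 1#)        ≈⟨ -‿cong (×-homo-+ 1# (suc m) (suc n)) ⟩
    - (suc m ×ᵣ 1# + suc n ×ᵣ 1#)      ≈⟨ sym (-‿+-comm _ _) ⟩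
    - (suc m ×ᵣ 1#) + - (suc n ×ᵣ 1#)  ∎
  fromℤ-+ -[1+ m ] (+ n)    = trans (fromℤ-⊖ n (suc m)) (+-comm _ _)
  fromℤ-+ (+ m)    -[1+ n ] = fromℤ-⊖ m (suc n)
  fromℤ-+ (+ m)    (+ n)    = ×-homo-+ 1# m n

  fromℤ-* : ∀ i j → fromℤ (i ℤ.* j) ≈ fromℤ i * fromℤ j
  fromℤ-* i j = begin
    fromℤ (s ℤ.◃ ℤ.∣ i ∣ ℕ.* ℤ.∣ j ∣)          ≈⟨ fromℤ-◃ s (ℤ.∣ i ∣ ℕ.* ℤ.∣ j ∣) ⟩
    signed s ((ℤ.∣ i ∣ ℕ.* ℤ.∣ j ∣) ×ᵣ 1#)     ≈⟨ signed-cong s (×1-homo-* ℤ.∣ i ∣ ℤ.∣ j ∣) ⟩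
    signed s (ℤ.∣ i ∣ ×ᵣ 1# * ℤ.∣ j ∣ ×ᵣ 1#)   ≈⟨ signed-* (ℤ.sign i) (ℤ.sign j) ⟩
    signed (ℤ.sign i) (ℤ.∣ i ∣ ×ᵣ 1#) * signed (ℤ.sign j) (ℤ.∣ j ∣ ×ᵣ 1#)
                                               ≈⟨ *-cong (signed-sign-abs i) (signed-sign-abs j) ⟩
    fromℤ i * fromℤ j                          ∎
    where
    s : Sign
    s = ℤ.sign i Sign.* ℤ.sign j
    signed-cong : ∀ s {x y} → x ≈ y → signed s x ≈ signed s y
    signed-cong Sign.+ = id
    signed-cong Sign.- = -‿cong
    signed-* : ∀ s t {x y} → signed (s Sign.* t) (x * y) ≈ signed s x * signed t y
    signed-* Sign.+ Sign.+ = refl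
    signed-* Sign.+ Sign.- = -‿distribʳ-* _ _
    signed-* Sign.- Sign.+ = -‿distribˡ-* _ _
    signed-* Sign.- Sign.- {x} {y} = begin
      x * y          ≈⟨ sym (-‿involutive _) ⟩
      - - (x * y)    ≈⟨ -‿cong (-‿distribˡ-* x y) ⟩
      - (- x * y)    ≈⟨ -‿distribʳ-* (- x) y ⟩
      - x * - y      ∎
    signed-sign-abs : ∀ i → signed (ℤ.sign i) (ℤ.∣ i ∣ ×ᵣ 1#) ≈ fromℤ i
    signed-sign-abs (+ zero)  = refl
    signed-sign-abs (+ suc n) = refl
    signed-sign-abs -[1+ n ]  = refl

  fromℤ-‿ : ∀ i → fromℤ (ℤ.- i) ≈ - fromℤ i
  fromℤ-‿ (+ zero)  = sym -0#≈0#
  fromℤ-‿ (+ suc n) = refl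
  fromℤ-‿ -[1+ n ]  = sym (-‿involutive _)

  fromℤ-homomorphism : ℤ.+-*-rawRing -Raw-AlmostCommutative⟶ fromCommutativeRing R
  fromℤ-homomorphism = record
    { ⟦_⟧ = fromℤ ; +-homo = fromℤ-+ ; *-homo = fromℤ-* ; -‿homo = fromℤ-‿ ; 0-homo = refl ; 1-homo = refl }

  _≟ℤ_ : ∀ i j → Maybe (fromℤ i ≈ fromℤ j)
  i ≟ℤ j with i ℤ.≟ j
  ... | yes ≡.refl = just refl
  ... | no _       = nothing

  open import Algebra.Solver.Ring ℤ.+-*-rawRing (fromCommutativeRing R) fromℤ-homomorphism _≟ℤ_ public

  :0 :1 :2 : ∀ {m} → Polynomial m
  :0 = con (+ 0)
  :1 = con (+ 1)
  :2 = :1 :+ :1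

infixl 1 _>>=_

_>>=_ : ∀ {a b} {A : Set a} {B : Set b} → ¬ ¬ A → (A → ¬ ¬ B) → ¬ ¬ B
(¬¬a >>= f) ¬b = ¬¬a (λ a → f a ¬b)

¬¬-intro : ∀ {a} {A : Set a} → A → ¬ ¬ A
¬¬-intro = contradiction

¬¬-Π : ∀ {p} m {P : Fin m → Set p} → (∀ i → ¬ ¬ P i) → ¬ ¬ (∀ i → P i)
¬¬-Π zero    h = ¬¬-intro λ ()
¬¬-Π (suc m) h = do
  p₀ ← h zero
  ps ← ¬¬-Π m (h ∘ suc)
  ¬¬-intro λ where
    zero    → p₀
    (suc i) → ps i

¬∀⇒¬¬∃¬ : ∀ {p} m {P : Fin m → Set p} → ¬ (∀ i → P i) → ¬ ¬ (∃ λ i → ¬ P i)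
¬∀⇒¬¬∃¬ m ¬∀ ¬∃¬ = ¬¬-Π m (λ i ¬Pi → ¬∃¬ (i , ¬Pi)) ¬∀

¬¬-→ : ∀ {a b} {A : Set a} {B : Set b} → (A → ¬ ¬ B) → ¬ ¬ (A → B)
¬¬-→ h ¬[a→b] = ¬[a→b] (λ a → ⊥-elim (h a (λ b → ¬[a→b] (λ _ → b))))

-- Counting ones

interval : ∀ {n} → ℕ → ℕ → Fin n → Bool
interval zero    k j       = toℕ j ℕ.<ᵇ k
interval (suc m) k zero    = false
interval (suc m) k (suc j) = interval m (k ℕ.∸ 1) j

countOnes-interval : ∀ {n} m k → m ≤ k → k ≤ n → countOnes (interval {n} m k) ≡ k ℕ.∸ m
countOnes-interval {zero}  zero    zero    _         _         = ≡.refl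
countOnes-interval {suc n} zero    zero    _         _         = countOnes-interval {n} zero zero z≤n z≤n
countOnes-interval {suc n} zero    (suc k) _         (s≤s k≤n) = ≡.cong suc (countOnes-interval zero k z≤n k≤n)
countOnes-interval {suc n} (suc m) (suc k) (s≤s m≤k) (s≤s k≤n) = countOnes-interval m k m≤k k≤n

module ℕ-Σ = CommutativeMonoidSum ℕ.+-0-commutativeMonoid

countOnes≡sum : ∀ {n} (x : Fin n → Bool) → countOnes x ≡ ℕ-Σ.sum (λ i → if x i then 1 else 0)
countOnes≡sum {zero}  x = ≡.refl
countOnes≡sum {suc n} x = ≡.cong ((if x zero then 1 else 0) ℕ.+_) (countOnes≡sum (x ∘ suc))

countOnes-permute : ∀ {n} (π : Permutation′ n) (x : Fin n → Bool) → countOnes (x ∘ (π ⟨$⟩ˡ_)) ≡ countOnes x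
countOnes-permute {n} π x = begin
  countOnes (x ∘ (π ⟨$⟩ˡ_))                               ≡⟨ countOnes≡sum (x ∘ (π ⟨$⟩ˡ_)) ⟩
  ℕ-Σ.sum (λ i → if x (π ⟨$⟩ˡ i) then 1 else 0)           ≡⟨ ℕ-Σ.sum-permute {n} {n} _ π ⟩
  ℕ-Σ.sum (λ i → if x (π ⟨$⟩ˡ (π ⟨$⟩ʳ i)) then 1 else 0)  ≡⟨ ℕ-Σ.sum-cong-≗ {n} (λ _ → ≡.cong indicator (Perm.inverseˡ π)) ⟩
  ℕ-Σ.sum (λ i → if x i then 1 else 0)                    ≡⟨ countOnes≡sum x ⟨
  countOnes x                                             ∎
  where
  open ≡.≡-Reasoning
  indicator : Fin n → ℕ
  indicator j = if x j then 1 else 0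

countOnes-not : ∀ {n} (x : Fin n → Bool) → countOnes x ℕ.+ countOnes (not ∘ x) ≡ n
countOnes-not {zero}  x = ≡.refl
countOnes-not {suc n} x with x zero
... | true  = ≡.cong suc (countOnes-not (x ∘ suc))
... | false = ≡.trans (ℕ.+-suc _ _) (≡.cong suc (countOnes-not (x ∘ suc)))

countOnes≡n∸k⇒countOnes-not≡k : ∀ {n k} (x : Fin n → Bool) → k ≤ n → countOnes x ≡ n ℕ.∸ k → countOnes (not ∘ x) ≡ k
countOnes≡n∸k⇒countOnes-not≡k {n} {k} x k≤n x-count = begin
  countOnes (not ∘ x)                                  ≡⟨ ℕ.m+n∸m≡n (countOnes x) (countOnes (not ∘ x)) ⟨
  countOnes x ℕ.+ countOnes (not ∘ x) ℕ.∸ countOnes x  ≡⟨ ≡.cong₂ ℕ._∸_ (countOnes-not x) x-count ⟩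
  n ℕ.∸ (n ℕ.∸ k)                                      ≡⟨ ℕ.m∸[m∸n]≡n k≤n ⟩
  k                                                    ∎
  where open ≡.≡-Reasoning

countOnes-not≡k⇒countOnes≡n∸k : ∀ {n k} (x : Fin n → Bool) → countOnes (not ∘ x) ≡ k → countOnes x ≡ n ℕ.∸ k
countOnes-not≡k⇒countOnes≡n∸k {n} {k} x not-x-count = begin
  countOnes x                                                  ≡⟨ ℕ.m+n∸n≡m (countOnes x) (countOnes (not ∘ x)) ⟨
  countOnes x ℕ.+ countOnes (not ∘ x) ℕ.∸ countOnes (not ∘ x)  ≡⟨ ≡.cong₂ ℕ._∸_ (countOnes-not x) not-x-count ⟩
  n ℕ.∸ k                                                      ∎
  where open ≡.≡-Reasoning

countOnes≡k⇒EXACT : ∀ {n k} (x : Fin n → Bool) → countOnes x ≡ k → EXACT n k x ≡ true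
countOnes≡k⇒EXACT x = Equivalence.to T-≡ ∘ ℕ.≡⇒≡ᵇ (countOnes x) _

EXACT⇒countOnes≡k : ∀ {n k} (x : Fin n → Bool) → EXACT n k x ≡ true → countOnes x ≡ k
EXACT⇒countOnes≡k x = ℕ.≡ᵇ⇒≡ (countOnes x) _ ∘ Equivalence.from T-≡

module _ {c ℓ} (K : ConjField c ℓ) where
  open ConjField K hiding (zero)
  open import Algebra.Properties.Ring ring
    using (-0#≈0#; -‿involutive; +-inverseʳ-unique; +-cancelʳ; -‿distribʳ-*; x+x≈x⇒x≈0; x∙y⁻¹≈ε⇒x≈y)
  open ℤ-CoefficientSolver commRing using (solve; _:=_; _:+_; _:*_; _:-_; :-_; :0; :1; :2)
  open import Relation.Binary.Reasoning.Setoid setoid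

  -- The fixed field of conj is formally real

  Real : Carrier → Set ℓ
  Real x = conj x ≈ x

  conj-0# : conj 0# ≈ 0#
  conj-0# = x+x≈x⇒x≈0 _ (trans (sym (conj-+ 0# 0#)) (conj-cong (+-identityʳ 0#)))

  conj-‿ : ∀ x → conj (- x) ≈ - conj x
  conj-‿ x = +-inverseʳ-unique (conj x) (conj (- x))
    (trans (sym (conj-+ x (- x))) (trans (conj-cong (-‿inverseʳ x)) conj-0#))

  conj≈0⇒≈0 : ∀ {x} → conj x ≈ 0# → x ≈ 0#
  conj≈0⇒≈0 {x} conj-x≈0 = trans (sym (conj-involutive x)) (trans (conj-cong conj-x≈0) conj-0#)

  Real-resp-≈ : ∀ {x y} → x ≈ y → Real x → Real y
  Real-resp-≈ x≈y rx = trans (conj-cong (sym x≈y)) (trans rx x≈y)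

  Real-1# : Real 1#
  Real-1# = conj-1

  Real-+ : ∀ {x y} → Real x → Real y → Real (x + y)
  Real-+ rx ry = trans (conj-+ _ _) (+-cong rx ry)

  Real-‿ : ∀ {x} → Real x → Real (- x)
  Real-‿ rx = trans (conj-‿ _) (-‿cong rx)

  Real-* : ∀ {x y} → Real x → Real y → Real (x * y)
  Real-* rx ry = trans (conj-* _ _) (*-cong rx ry)

  Real-x+conj[x] : ∀ x → Real (x + conj x)
  Real-x+conj[x] x = trans (conj-+ _ _) (trans (+-congˡ (conj-involutive x)) (+-comm _ _))

  Real-⁻¹ : ∀ {x y} → Real x → x * y ≈ 1# → Real y
  Real-⁻¹ {x} {y} rx xy≈1 = begin
    conj y                                 ≈⟨ solve 3 (λ a x y → a := (y :* x) :* a :+ (:1 :- x :* y) :* a) refl (conj y) x y ⟩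
    (y * x) * conj y + (1# - x * y) * conj y ≈⟨ +-cong (*-assoc _ _ _) (*-congʳ (trans (+-congˡ (-‿cong xy≈1)) (-‿inverseʳ 1#))) ⟩
    y * (x * conj y) + 0# * conj y         ≈⟨ +-cong (*-congˡ x*conj[y]≈1) (zeroˡ _) ⟩
    y * 1# + 0#                            ≈⟨ trans (+-identityʳ _) (*-identityʳ _) ⟩
    y                                      ∎
    where
    x*conj[y]≈1 : x * conj y ≈ 1#
    x*conj[y]≈1 = trans (*-congʳ (sym rx)) (trans (sym (conj-* x y)) (trans (conj-cong xy≈1) conj-1))

  x≉0∧x*y≈0⇒y≈0 : ∀ {x y} → ¬ x ≈ 0# → x * y ≈ 0# → y ≈ 0#
  x≉0∧x*y≈0⇒y≈0 {x} {y} x≉0 xy≈0 = begin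
    y                                    ≈⟨ solve 3 (λ y x z → y := z :* (x :* y) :+ (:1 :- x :* z) :* y) refl y x x⁻¹ ⟩
    x⁻¹ * (x * y) + (1# - x * x⁻¹) * y   ≈⟨ +-cong (*-congˡ xy≈0) (*-congʳ (trans (+-congˡ (-‿cong xx⁻¹≈1)) (-‿inverseʳ 1#))) ⟩
    x⁻¹ * 0# + 0# * y                    ≈⟨ trans (+-cong (zeroʳ _) (zeroˡ _)) (+-identityʳ _) ⟩
    0#                                   ∎
    where
    x⁻¹ : Carrier
    x⁻¹ = proj₁ (inverse x x≉0)
    xx⁻¹≈1 : x * x⁻¹ ≈ 1#
    xx⁻¹≈1 = proj₂ (inverse x x≉0)

  x*x≈0⇒¬¬x≈0 : ∀ x → x * x ≈ 0# → ¬ ¬ x ≈ 0#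
  x*x≈0⇒¬¬x≈0 x xx≈0 x≉0 = x≉0 (x≉0∧x*y≈0⇒y≈0 x≉0 xx≈0)

  conj[x]*x≈0⇒¬¬x≈0 : ∀ x → conj x * x ≈ 0# → ¬ ¬ x ≈ 0#
  conj[x]*x≈0⇒¬¬x≈0 x conj[x]x≈0 x≉0 = x≉0 (conj≈0⇒≈0 (x≉0∧x*y≈0⇒y≈0 x≉0 (trans (*-comm _ _) conj[x]x≈0)))

  quadratic-root : ∀ p q → ∃ λ x → x * x + p * x + q ≈ 0#
  quadratic-root p q with algClosed 1 (λ { zero → q ; (suc zero) → p })
  ... | x , root = x , trans
    (solve 3 (λ x p q → x :* x :+ p :* x :+ q := x :* (x :* :1) :+ (q :* :1 :+ (p :* (x :* :1) :+ :0))) refl x p q) root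

  square-root : ∀ u → ∃ λ z → z * z ≈ u
  square-root u with quadratic-root 0# (- u)
  ... | z , root = z , (begin
    z * z                     ≈⟨ solve 2 (λ z u → z :* z := (z :* z :+ :0 :* z :- u) :+ u) refl z u ⟩
    (z * z + 0# * z - u) + u  ≈⟨ +-congʳ root ⟩
    0# + u                    ≈⟨ +-identityˡ u ⟩
    u                         ∎)

  module Characteristic2 (1+1≈0 : 1# + 1# ≈ 0#) where

    2*x≈0 : ∀ x → (1# + 1#) * x ≈ 0#
    2*x≈0 x = trans (*-congʳ 1+1≈0) (zeroˡ x)

    x+x≈0 : ∀ x → x + x ≈ 0#
    x+x≈0 x = trans (solve 1 (λ x → x :+ x := :2 :* x) refl x) (2*x≈0 x)

    -x≈x : ∀ x → - x ≈ x
    -x≈x x = sym (+-inverseʳ-unique x x (x+x≈0 x))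

    module _ (w : Carrier) (conj-w : conj w ≈ 1# + w) where

      ¬Real-≈w : ∀ {x} → Real x → ¬ x ≈ w
      ¬Real-≈w rx x≈w = 1≉0 (sym (+-cancelʳ w 0# 1# (begin
        0# + w    ≈⟨ +-identityˡ w ⟩
        w         ≈⟨ sym (Real-resp-≈ x≈w rx) ⟩
        conj w    ≈⟨ conj-w ⟩
        1# + w    ∎)))

      Real-artinSchreier : ∀ a → Real a → ∃ λ γ → Real γ × γ * γ + γ ≈ a
      Real-artinSchreier a ra = β + conj β , Real-x+conj[x] β , (begin
        (β + conj β) * (β + conj β) + (β + conj β)
          ≈⟨ solve 2 (λ b s → (b :+ s) :* (b :+ s) :+ (b :+ s) := (b :* b :+ b) :+ (s :* s :+ s) :+ :2 :* (b :* s)) refl β (conj β) ⟩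
        (β * β + β) + (conj β * conj β + conj β) + (1# + 1#) * (β * conj β)
          ≈⟨ +-cong (+-cong β²+β≈aw (trans (+-congʳ (sym (conj-* β β))) (trans (sym (conj-+ _ _)) (conj-cong β²+β≈aw)))) (2*x≈0 _) ⟩
        (a * w + conj (a * w)) + 0#
          ≈⟨ trans (+-identityʳ _) (+-congˡ (trans (conj-* a w) (*-cong ra conj-w))) ⟩
        a * w + a * (1# + w)
          ≈⟨ solve 2 (λ a w → a :* w :+ a :* (:1 :+ w) := :2 :* (a :* w) :+ a) refl a w ⟩
        (1# + 1#) * (a * w) + a
          ≈⟨ trans (+-congʳ (2*x≈0 _)) (+-identityˡ a) ⟩
        a ∎)
        where
        β : Carrier
        β = proj₁ (quadratic-root 1# (- (a * w)))
        β²+β≈aw : β * β + β ≈ a * w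
        β²+β≈aw = begin
          β * β + β                         ≈⟨ solve 2 (λ b x → b :* b :+ b := (b :* b :+ :1 :* b :- x) :+ x) refl β (a * w) ⟩
          (β * β + 1# * β - a * w) + a * w  ≈⟨ +-congʳ (proj₂ (quadratic-root 1# (- (a * w)))) ⟩
          0# + a * w                        ≈⟨ +-identityˡ _ ⟩
          a * w                             ∎

      Real-w²+w : Real (w * w + w)
      Real-w²+w = begin
        conj (w * w + w)                    ≈⟨ trans (conj-+ _ _) (+-congʳ (conj-* w w)) ⟩
        conj w * conj w + conj w            ≈⟨ +-cong (*-cong conj-w conj-w) conj-w ⟩
        (1# + w) * (1# + w) + (1# + w)      ≈⟨ solve 1 (λ w → (:1 :+ w) :* (:1 :+ w) :+ (:1 :+ w) := :2 :* (:1 :+ w) :+ (w :* w :+ w)) refl w ⟩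
        (1# + 1#) * (1# + w) + (w * w + w)  ≈⟨ trans (+-congʳ (2*x≈0 _)) (+-identityˡ _) ⟩
        w * w + w                           ∎

      -- w² + w is real, so w is γ or γ + 1 for a real root γ of γ² + γ = w² + w.
      artinSchreier-contradiction : ⊥
      artinSchreier-contradiction = ¬Real-≈w (Real-+ rγ Real-1#) (sym w≈γ+1)
        where
        γ : Carrier
        γ = proj₁ (Real-artinSchreier (w * w + w) Real-w²+w)
        rγ : Real γ
        rγ = proj₁ (proj₂ (Real-artinSchreier (w * w + w) Real-w²+w))
        γ²+γ≈w²+w : γ * γ + γ ≈ w * w + w
        γ²+γ≈w²+w = proj₂ (proj₂ (Real-artinSchreier (w * w + w) Real-w²+w))
        product≈0 : (γ + w) * (γ + w + 1#) ≈ 0#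
        product≈0 = begin
          (γ + w) * (γ + w + 1#)
            ≈⟨ solve 2 (λ g w → (g :+ w) :* (g :+ w :+ :1) := (g :* g :+ g) :+ (w :* w :+ w) :+ :2 :* (g :* w)) refl γ w ⟩
          (γ * γ + γ) + (w * w + w) + (1# + 1#) * (γ * w)
            ≈⟨ +-cong (+-congʳ γ²+γ≈w²+w) (2*x≈0 _) ⟩
          (w * w + w) + (w * w + w) + 0#
            ≈⟨ trans (+-identityʳ _) (x+x≈0 _) ⟩
          0# ∎
        γ+w≉0 : ¬ γ + w ≈ 0#
        γ+w≉0 γ+w≈0 = ¬Real-≈w rγ (trans (sym (-x≈x γ)) (sym (+-inverseʳ-unique γ w γ+w≈0)))
        w≈γ+1 : w ≈ γ + 1#
        w≈γ+1 = begin
          w                        ≈⟨ solve 2 (λ g w → w := (g :+ w :+ :1) :- (g :+ :1)) refl γ w ⟩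
          (γ + w + 1#) - (γ + 1#)  ≈⟨ +-cong (x≉0∧x*y≈0⇒y≈0 γ+w≉0 product≈0) (-x≈x _) ⟩
          0# + (γ + 1#)            ≈⟨ +-identityˡ _ ⟩
          γ + 1#                   ∎

  -- For t with conj t ≉ t, the element w = t / (t + conj t) satisfies conj w = 1 + w in
  -- characteristic 2.
  1+1≉0 : ¬ 1# + 1# ≈ 0#
  1+1≉0 1+1≈0 = artinSchreier-contradiction w conj-w
    where
    open Characteristic2 1+1≈0
    t u u⁻¹ w : Carrier
    t = proj₁ conj-nontrivial
    u = t + conj t
    u≉0 : ¬ u ≈ 0#
    u≉0 u≈0 = proj₂ conj-nontrivial (trans (+-inverseʳ-unique t (conj t) u≈0) (-x≈x t))
    u⁻¹ = proj₁ (inverse u u≉0)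
    uu⁻¹≈1 : u * u⁻¹ ≈ 1#
    uu⁻¹≈1 = proj₂ (inverse u u≉0)
    w = t * u⁻¹
    conj-t≈u+t : conj t ≈ u + t
    conj-t≈u+t = begin
      conj t                 ≈⟨ solve 2 (λ t s → s := (t :+ s) :+ t :- :2 :* t) refl t (conj t) ⟩
      u + t - (1# + 1#) * t  ≈⟨ +-congˡ (trans (-‿cong (2*x≈0 t)) -0#≈0#) ⟩
      u + t + 0#             ≈⟨ +-identityʳ _ ⟩
      u + t                  ∎
    conj-w : conj w ≈ 1# + w
    conj-w = begin
      conj (t * u⁻¹)  ≈⟨ trans (conj-* t u⁻¹) (*-cong conj-t≈u+t (Real-⁻¹ (Real-x+conj[x] t) uu⁻¹≈1)) ⟩
      (u + t) * u⁻¹   ≈⟨ distribʳ _ _ _ ⟩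
      u * u⁻¹ + w     ≈⟨ +-congʳ uu⁻¹≈1 ⟩
      1# + w          ∎

  record ImaginaryUnit : Set (c Level.⊔ ℓ) where
    field
      i      : Carrier
      i*i≈-1 : i * i ≈ - 1#
      conj-i : conj i ≈ - i

    ¬Real-≈i : ∀ {x} → Real x → ¬ x ≈ i
    ¬Real-≈i rx x≈i = 1+1≉0 (begin
      1# + 1#     ≈⟨ +-congʳ (sym i*i≈1) ⟩
      i * i + 1#  ≈⟨ +-congʳ i*i≈-1 ⟩
      - 1# + 1#   ≈⟨ -‿inverseˡ 1# ⟩
      0#          ∎)
      where
      i≈-i : i ≈ - i
      i≈-i = trans (sym (Real-resp-≈ x≈i rx)) conj-i
      i*i≈1 : i * i ≈ 1#
      i*i≈1 = begin
        i * i      ≈⟨ *-congˡ i≈-i ⟩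
        i * - i    ≈⟨ sym (-‿distribʳ-* i i) ⟩
        - (i * i)  ≈⟨ -‿cong i*i≈-1 ⟩
        - - 1#     ≈⟨ -‿involutive 1# ⟩
        1#         ∎

  -- For t with conj t ≉ t and z² = t - conj t, take i = conj z / z.
  imaginaryUnit : ImaginaryUnit
  imaginaryUnit = record { i = i ; i*i≈-1 = i*i≈-1 ; conj-i = conj-i }
    where
    t u z z⁻¹ i : Carrier
    t = proj₁ conj-nontrivial
    u = t - conj t
    conj-u : conj u ≈ - u
    conj-u = begin
      conj (t - conj t)  ≈⟨ trans (conj-+ _ _) (+-congˡ (trans (conj-‿ _) (-‿cong (conj-involutive t)))) ⟩
      conj t - t         ≈⟨ solve 2 (λ t s → s :- t := :- (t :- s)) refl t (conj t) ⟩
      - u                ∎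
    z = proj₁ (square-root u)
    z*z≈u : z * z ≈ u
    z*z≈u = proj₂ (square-root u)
    z≉0 : ¬ z ≈ 0#
    z≉0 z≈0 = proj₂ conj-nontrivial (sym (x∙y⁻¹≈ε⇒x≈y t (conj t) (trans (sym z*z≈u) (trans (*-congʳ z≈0) (zeroˡ z)))))
    z⁻¹ = proj₁ (inverse z z≉0)
    zz⁻¹≈1 : z * z⁻¹ ≈ 1#
    zz⁻¹≈1 = proj₂ (inverse z z≉0)
    i = conj z * z⁻¹
    i*i≈-1 : i * i ≈ - 1#
    i*i≈-1 = begin
      i * i                             ≈⟨ solve 2 (λ s y → (s :* y) :* (s :* y) := (s :* s) :* (y :* y)) refl (conj z) z⁻¹ ⟩
      (conj z * conj z) * (z⁻¹ * z⁻¹)   ≈⟨ *-congʳ (trans (sym (conj-* z z)) (trans (conj-cong z*z≈u) (trans conj-u (-‿cong (sym z*z≈u))))) ⟩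
      - (z * z) * (z⁻¹ * z⁻¹)           ≈⟨ solve 2 (λ z y → (:- (z :* z)) :* (y :* y) := :- ((z :* y) :* (z :* y))) refl z z⁻¹ ⟩
      - ((z * z⁻¹) * (z * z⁻¹))         ≈⟨ -‿cong (trans (*-cong zz⁻¹≈1 zz⁻¹≈1) (*-identityʳ 1#)) ⟩
      - 1#                              ∎
    i*conj-i≈1 : i * conj i ≈ 1#
    i*conj-i≈1 = begin
      i * conj i                        ≈⟨ *-congˡ (trans (conj-* _ _) (*-congʳ (conj-involutive z))) ⟩
      (conj z * z⁻¹) * (z * conj z⁻¹)   ≈⟨ solve 4 (λ s y z r → (s :* y) :* (z :* r) := (s :* r) :* (z :* y)) refl (conj z) z⁻¹ z (conj z⁻¹) ⟩
      (conj z * conj z⁻¹) * (z * z⁻¹)   ≈⟨ *-cong (trans (sym (conj-* z z⁻¹)) (trans (conj-cong zz⁻¹≈1) conj-1)) zz⁻¹≈1 ⟩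
      1# * 1#                           ≈⟨ *-identityʳ 1# ⟩
      1#                                ∎
    conj-i : conj i ≈ - i
    conj-i = begin
      conj i                ≈⟨ solve 1 (λ x → x := :- ((:- :1) :* x)) refl (conj i) ⟩
      - (- 1# * conj i)     ≈⟨ -‿cong (*-congʳ (sym i*i≈-1)) ⟩
      - ((i * i) * conj i)  ≈⟨ -‿cong (trans (*-assoc _ _ _) (trans (*-congˡ i*conj-i≈1) (*-identityʳ i))) ⟩
      - i                   ∎

  open ImaginaryUnit imaginaryUnit

  IsRealSquare : Carrier → Set (c Level.⊔ ℓ)
  IsRealSquare x = ∃ λ e → Real e × x ≈ e * e

  IsRealSquare-0# : IsRealSquare 0#
  IsRealSquare-0# = 0# , conj-0# , sym (zeroˡ 0#)

  -- Writing x = z², conj x · x is the square of the real number conj z · z.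
  IsRealSquare-conj[x]*x : ∀ x → IsRealSquare (conj x * x)
  IsRealSquare-conj[x]*x x = conj z * z , Real-conj[z]*z , (begin
    conj x * x                   ≈⟨ *-cong (conj-cong (sym z*z≈x)) (sym z*z≈x) ⟩
    conj (z * z) * (z * z)       ≈⟨ *-congʳ (conj-* z z) ⟩
    (conj z * conj z) * (z * z)  ≈⟨ solve 2 (λ s z → (s :* s) :* (z :* z) := (s :* z) :* (s :* z)) refl (conj z) z ⟩
    (conj z * z) * (conj z * z)  ∎)
    where
    z : Carrier
    z = proj₁ (square-root x)
    z*z≈x : z * z ≈ x
    z*z≈x = proj₂ (square-root x)
    Real-conj[z]*z : Real (conj z * z)
    Real-conj[z]*z = trans (conj-* _ _) (trans (*-congʳ (conj-involutive z)) (*-comm _ _))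

  -- e² + f² = conj w · w for w = e + f i.
  IsRealSquare-+ : ∀ {x y} → IsRealSquare x → IsRealSquare y → IsRealSquare (x + y)
  IsRealSquare-+ {x} {y} (e , re , x≈e²) (f , rf , y≈f²) =
    let (g , rg , conj[w]*w≈g²) = IsRealSquare-conj[x]*x (e + f * i) in g , rg , trans x+y≈conj[w]*w conj[w]*w≈g²
    where
    x+y≈conj[w]*w : x + y ≈ conj (e + f * i) * (e + f * i)
    x+y≈conj[w]*w = begin
      x + y                        ≈⟨ +-cong x≈e² y≈f² ⟩
      e * e + f * f                ≈⟨ solve 2 (λ e f → e :* e :+ f :* f := e :* e :- f :* f :* (:- :1)) refl e f ⟩
      e * e - f * f * - 1#         ≈⟨ +-congˡ (-‿cong (*-congˡ (sym i*i≈-1))) ⟩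
      e * e - f * f * (i * i)      ≈⟨ solve 3 (λ e f i → e :* e :- f :* f :* (i :* i) := (e :+ f :* (:- i)) :* (e :+ f :* i)) refl e f i ⟩
      (e + f * - i) * (e + f * i)  ≈⟨ *-congʳ (sym (trans (conj-+ _ _) (+-cong re (trans (conj-* f i) (*-cong rf conj-i))))) ⟩
      conj (e + f * i) * (e + f * i) ∎

  IsRealSquare-Σ : ∀ m {g : Fin m → Carrier} → (∀ q → IsRealSquare (g q)) → IsRealSquare (Σ m g)
  IsRealSquare-Σ zero    squares = IsRealSquare-0#
  IsRealSquare-Σ (suc m) squares = IsRealSquare-+ (squares zero) (IsRealSquare-Σ m (squares ∘ suc))

  -- If f ≉ 0 then e / f would be a real square root of -1, that is ±i.
  e²+f²≈0⇒¬¬[e≈0∧f≈0] : ∀ {e f} → Real e → Real f → e * e + f * f ≈ 0# → ¬ ¬ (e ≈ 0# × f ≈ 0#)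
  e²+f²≈0⇒¬¬[e≈0∧f≈0] {e} {f} re rf e²+f²≈0 = do
    f≈0 ← ¬¬f≈0
    e≈0 ← x*x≈0⇒¬¬x≈0 e (begin
      e * e                    ≈⟨ solve 2 (λ e f → e :* e := (e :* e :+ f :* f) :- f :* f) refl e f ⟩
      (e * e + f * f) - f * f  ≈⟨ +-cong e²+f²≈0 (-‿cong (trans (*-congʳ f≈0) (zeroˡ f))) ⟩
      0# - 0#                  ≈⟨ -‿inverseʳ 0# ⟩
      0#                       ∎)
    ¬¬-intro (e≈0 , f≈0)
    where
    ¬¬f≈0 : ¬ ¬ f ≈ 0#
    ¬¬f≈0 f≉0 = ¬Real-≈i (Real-‿ rw) -w≈i
      where
      f⁻¹ w : Carrier
      f⁻¹ = proj₁ (inverse f f≉0)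
      ff⁻¹≈1 : f * f⁻¹ ≈ 1#
      ff⁻¹≈1 = proj₂ (inverse f f≉0)
      w = e * f⁻¹
      rw : Real w
      rw = Real-* re (Real-⁻¹ rf ff⁻¹≈1)
      w*w≈-1 : w * w ≈ - 1#
      w*w≈-1 = begin
        w * w
          ≈⟨ solve 3 (λ e f y → (e :* y) :* (e :* y) := (e :* e :+ f :* f) :* (y :* y) :- (f :* y) :* (f :* y)) refl e f f⁻¹ ⟩
        (e * e + f * f) * (f⁻¹ * f⁻¹) - (f * f⁻¹) * (f * f⁻¹)
          ≈⟨ +-cong (trans (*-congʳ e²+f²≈0) (zeroˡ _)) (-‿cong (trans (*-cong ff⁻¹≈1 ff⁻¹≈1) (*-identityʳ 1#))) ⟩
        0# - 1#
          ≈⟨ +-identityˡ _ ⟩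
        - 1# ∎
      [w-i][w+i]≈0 : (w - i) * (w + i) ≈ 0#
      [w-i][w+i]≈0 = begin
        (w - i) * (w + i)  ≈⟨ solve 2 (λ w i → (w :- i) :* (w :+ i) := w :* w :- i :* i) refl w i ⟩
        w * w - i * i      ≈⟨ +-cong w*w≈-1 (-‿cong i*i≈-1) ⟩
        - 1# - - 1#        ≈⟨ -‿inverseʳ _ ⟩
        0#                 ∎
      w-i≉0 : ¬ w - i ≈ 0#
      w-i≉0 w-i≈0 = ¬Real-≈i rw (x∙y⁻¹≈ε⇒x≈y w i w-i≈0)
      -w≈i : - w ≈ i
      -w≈i = sym (+-inverseʳ-unique w i (x≉0∧x*y≈0⇒y≈0 w-i≉0 [w-i][w+i]≈0))

  Σ-realSquares≈0 : ∀ m {g : Fin m → Carrier} → (∀ q → IsRealSquare (g q)) → Σ m g ≈ 0# → ¬ ¬ (∀ q → g q ≈ 0#)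
  Σ-realSquares≈0 zero    squares Σ≈0 = ¬¬-intro λ ()
  Σ-realSquares≈0 (suc m) squares Σ≈0 = do
    let (e , re , head≈e²) = squares zero
        (f , rf , tail≈f²) = IsRealSquare-Σ m (squares ∘ suc)
    (e≈0 , f≈0) ← e²+f²≈0⇒¬¬[e≈0∧f≈0] re rf (trans (sym (+-cong head≈e² tail≈f²)) Σ≈0)
    tail≈0 ← Σ-realSquares≈0 m (squares ∘ suc) (trans tail≈f² (trans (*-congʳ f≈0) (zeroˡ f)))
    ¬¬-intro λ where
      zero    → trans head≈e² (trans (*-congʳ e≈0) (zeroˡ e))
      (suc q) → tail≈0 q

  -- Finite sums

  Σ-cong : ∀ m {f g : Fin m → Carrier} → (∀ q → f q ≈ g q) → Σ m f ≈ Σ m g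
  Σ-cong zero    f≈g = refl
  Σ-cong (suc m) f≈g = +-cong (f≈g zero) (Σ-cong m (f≈g ∘ suc))

  Σ-0# : ∀ m → Σ m (λ _ → 0#) ≈ 0#
  Σ-0# zero    = refl
  Σ-0# (suc m) = trans (+-identityˡ _) (Σ-0# m)

  Σ-+ : ∀ m (f g : Fin m → Carrier) → Σ m (λ q → f q + g q) ≈ Σ m f + Σ m g
  Σ-+ zero    f g = sym (+-identityʳ 0#)
  Σ-+ (suc m) f g = trans (+-congˡ (Σ-+ m (f ∘ suc) (g ∘ suc)))
    (solve 4 (λ a b x y → (a :+ b) :+ (x :+ y) := (a :+ x) :+ (b :+ y)) refl (f zero) (g zero) _ _)

  Σ--* : ∀ m (f g : Fin m → Carrier) a → Σ m (λ q → f q - a * g q) ≈ Σ m f - a * Σ m g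
  Σ--* zero    f g a = sym (trans (+-congˡ (trans (-‿cong (zeroʳ a)) -0#≈0#)) (+-identityʳ 0#))
  Σ--* (suc m) f g a = trans (+-congˡ (Σ--* m (f ∘ suc) (g ∘ suc) a))
    (solve 5 (λ f₀ g₀ a F G → (f₀ :- a :* g₀) :+ (F :- a :* G) := (f₀ :+ F) :- a :* (g₀ :+ G)) refl (f zero) (g zero) a _ _)

  *-distribˡ-Σ : ∀ m a (f : Fin m → Carrier) → a * Σ m f ≈ Σ m (λ q → a * f q)
  *-distribˡ-Σ zero    a f = zeroʳ a
  *-distribˡ-Σ (suc m) a f = trans (distribˡ _ _ _) (+-congˡ (*-distribˡ-Σ m a (f ∘ suc)))

  *-distribʳ-Σ : ∀ m a (f : Fin m → Carrier) → Σ m f * a ≈ Σ m (λ q → f q * a)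
  *-distribʳ-Σ m a f = trans (*-comm _ _) (trans (*-distribˡ-Σ m a f) (Σ-cong m (λ _ → *-comm _ _)))

  Σ-comm : ∀ m p (f : Fin m → Fin p → Carrier) → Σ m (λ i → Σ p (f i)) ≈ Σ p (λ j → Σ m (λ i → f i j))
  Σ-comm zero    p f = sym (Σ-0# p)
  Σ-comm (suc m) p f = trans (+-congˡ (Σ-comm m p (f ∘ suc))) (sym (Σ-+ p (f zero) _))

  conj-Σ : ∀ m (f : Fin m → Carrier) → conj (Σ m f) ≈ Σ m (λ q → conj (f q))
  conj-Σ zero    f = conj-0#
  conj-Σ (suc m) f = trans (conj-+ _ _) (+-congˡ (conj-Σ m (f ∘ suc)))

  Σ-δ : ∀ m (i : Fin m) (f : Fin m → Carrier) → Σ m (λ l → δ K i l * f l) ≈ f i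
  Σ-δ (suc m) zero    f = trans (+-cong (*-identityˡ _) (trans (Σ-cong m (λ _ → zeroˡ _)) (Σ-0# m))) (+-identityʳ _)
  Σ-δ (suc m) (suc i) f = trans (+-congʳ (zeroˡ _)) (trans (+-identityˡ _) (Σ-δ m i (f ∘ suc)))

  -- Vectors and linear maps

  infix  4 _≈ᵥ_
  infixl 6 _-ᵥ_
  infixr 7 _*ᵥ_

  _≈ᵥ_ : ∀ {d} → Vector K d → Vector K d → Set ℓ
  u ≈ᵥ v = ∀ q → u q ≈ v q

  0ᵥ : ∀ {d} → Vector K d
  0ᵥ _ = 0#

  _-ᵥ_ : ∀ {d} → Vector K d → Vector K d → Vector K d
  (u -ᵥ v) q = u q - v q

  _*ᵥ_ : ∀ {d} → Carrier → Vector K d → Vector K d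
  (a *ᵥ v) q = a * v q

  project : ∀ {d} → (Fin d → Bool) → Vector K d → Vector K d
  project acc v q = if acc q then v q else 0#

  acceptanceWeight : ∀ {d} → (Fin d → Bool) → Vector K d → Carrier
  acceptanceWeight {d} acc v = Σ d (λ q → if acc q then conj (v q) * v q else 0#)

  acceptanceWeight≈0⇒¬¬project≈0 : ∀ {d} acc (v : Vector K d) → acceptanceWeight acc v ≈ 0# → ¬ ¬ project acc v ≈ᵥ 0ᵥ
  acceptanceWeight≈0⇒¬¬project≈0 {d} acc v weight≈0 = do
    terms≈0 ← Σ-realSquares≈0 d (λ q → IsRealSquare-term (acc q) (v q)) weight≈0
    ¬¬-Π d (λ q → term≈0⇒¬¬entry≈0 (acc q) (v q) (terms≈0 q))
    where
    IsRealSquare-term : ∀ b x → IsRealSquare (if b then conj x * x else 0#)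
    IsRealSquare-term true  x = IsRealSquare-conj[x]*x x
    IsRealSquare-term false x = IsRealSquare-0#
    term≈0⇒¬¬entry≈0 : ∀ b x → (if b then conj x * x else 0#) ≈ 0# → ¬ ¬ (if b then x else 0#) ≈ 0#
    term≈0⇒¬¬entry≈0 true  x = conj[x]*x≈0⇒¬¬x≈0 x
    term≈0⇒¬¬entry≈0 false x _ = ¬¬-intro refl

  project≈0⇒acceptanceWeight≈0 : ∀ {d} acc (v : Vector K d) → project acc v ≈ᵥ 0ᵥ → acceptanceWeight acc v ≈ 0#
  project≈0⇒acceptanceWeight≈0 {d} acc v project≈0 =
    trans (Σ-cong d (λ q → entry≈0⇒term≈0 (acc q) (v q) (project≈0 q))) (Σ-0# d)
    where
    entry≈0⇒term≈0 : ∀ b x → (if b then x else 0#) ≈ 0# → (if b then conj x * x else 0#) ≈ 0#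
    entry≈0⇒term≈0 true  x x≈0 = trans (*-congˡ x≈0) (zeroʳ _)
    entry≈0⇒term≈0 false x _   = refl

  record IsLinear {d e} (f : Vector K d → Vector K e) : Set (c Level.⊔ ℓ) where
    field
      cong : ∀ {u v} → u ≈ᵥ v → f u ≈ᵥ f v
      homo : ∀ u a v → f (u -ᵥ a *ᵥ v) ≈ᵥ f u -ᵥ a *ᵥ f v

    0-homo : f 0ᵥ ≈ᵥ 0ᵥ
    0-homo q = begin
      f 0ᵥ q                ≈⟨ cong (λ _ → sym (x-1*x≈0 0#)) q ⟩
      f (0ᵥ -ᵥ 1# *ᵥ 0ᵥ) q  ≈⟨ homo 0ᵥ 1# 0ᵥ q ⟩
      f 0ᵥ q - 1# * f 0ᵥ q  ≈⟨ x-1*x≈0 _ ⟩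
      0#                    ∎
      where
      x-1*x≈0 : ∀ x → x - 1# * x ≈ 0#
      x-1*x≈0 x = trans (+-congˡ (-‿cong (*-identityˡ x))) (-‿inverseʳ x)

    image≉0⇒≉0 : ∀ {v} → ¬ f v ≈ᵥ 0ᵥ → ¬ v ≈ᵥ 0ᵥ
    image≉0⇒≉0 fv≉0 v≈0 = fv≉0 (λ q → trans (cong v≈0 q) (0-homo q))

    homo-kernel : ∀ u a {v} → f v ≈ᵥ 0ᵥ → f (u -ᵥ a *ᵥ v) ≈ᵥ f u
    homo-kernel u a {v} fv≈0 q = begin
      f (u -ᵥ a *ᵥ v) q  ≈⟨ homo u a v q ⟩
      f u q - a * f v q  ≈⟨ +-congˡ (-‿cong (trans (*-congˡ (fv≈0 q)) (zeroʳ a))) ⟩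
      f u q - 0#         ≈⟨ trans (+-congˡ -0#≈0#) (+-identityʳ _) ⟩
      f u q              ∎

  IsLinear-∘ : ∀ {d e f} {g : Vector K e → Vector K f} {h : Vector K d → Vector K e} →
               IsLinear g → IsLinear h → IsLinear (g ∘ h)
  IsLinear-∘ {g = g} {h} G H = record
    { cong = G.cong ∘ H.cong
    ; homo = λ u a v q → trans (G.cong (H.homo u a v) q) (G.homo (h u) a (h v) q)
    }
    where
    module G = IsLinear G
    module H = IsLinear H

  IsLinear-project : ∀ {d} (acc : Fin d → Bool) → IsLinear (project acc)
  IsLinear-project acc = record { cong = cong ; homo = homo }
    where
    cong : ∀ {u v} → u ≈ᵥ v → project acc u ≈ᵥ project acc v
    cong u≈v q with acc q
    ... | true  = u≈v q
    ... | false = refl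
    homo : ∀ u a v → project acc (u -ᵥ a *ᵥ v) ≈ᵥ project acc u -ᵥ a *ᵥ project acc v
    homo u a v q with acc q
    ... | true  = refl
    ... | false = sym (trans (+-congˡ (trans (-‿cong (zeroʳ a)) -0#≈0#)) (+-identityʳ 0#))

  insertAt-cong : ∀ {d} {u v : Vector K d} {a b} l → u ≈ᵥ v → a ≈ b → insertAt u l a ≈ᵥ insertAt v l b
  insertAt-cong         zero    u≈v a≈b zero    = a≈b
  insertAt-cong         zero    u≈v a≈b (suc q) = u≈v q
  insertAt-cong {suc d} (suc l) u≈v a≈b zero    = u≈v zero
  insertAt-cong {suc d} (suc l) u≈v a≈b (suc q) = insertAt-cong l (u≈v ∘ suc) a≈b q

  IsLinear-insertAt-0# : ∀ {d} (l : Fin (suc d)) → IsLinear (λ v → insertAt v l 0#)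
  IsLinear-insertAt-0# l = record { cong = λ u≈v → insertAt-cong l u≈v refl ; homo = homo l }
    where
    homo : ∀ {d} (l : Fin (suc d)) u a v → insertAt (u -ᵥ a *ᵥ v) l 0# ≈ᵥ insertAt u l 0# -ᵥ a *ᵥ insertAt v l 0#
    homo         zero    u a v zero    = sym (trans (+-congˡ (trans (-‿cong (zeroʳ a)) -0#≈0#)) (+-identityʳ 0#))
    homo         zero    u a v (suc q) = refl
    homo {suc d} (suc l) u a v zero    = refl
    homo {suc d} (suc l) u a v (suc q) = homo l (u ∘ suc) a (v ∘ suc) q

  insertAt-removeAt-0# : ∀ {d} (v : Vector K (suc d)) l → v l ≈ 0# → insertAt (removeAt v l) l 0# ≈ᵥ v
  insertAt-removeAt-0# v l vl≈0 q =
    trans (insertAt-cong l (λ _ → refl) (sym vl≈0) q) (reflexive (Vecₚ.insertAt-removeAt v l q))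

  record TriangularFamily (d e p : ℕ) : Set (c Level.⊔ ℓ) where
    field
      vector   : Fin p → Vector K d
      map      : Fin p → Vector K d → Vector K e
      linear   : ∀ i → IsLinear (map i)
      lower    : ∀ i j → j Fin.< i → map i (vector j) ≈ᵥ 0ᵥ
      diagonal : ∀ i → ¬ map i (vector i) ≈ᵥ 0ᵥ

  vector₀≉0 : ∀ {d e p} (T : TriangularFamily d e (suc p)) → ¬ TriangularFamily.vector T zero ≈ᵥ 0ᵥ
  vector₀≉0 T = IsLinear.image≉0⇒≉0 (linear zero) (diagonal zero)
    where open TriangularFamily T

  -- Clear coordinate l of the later vectors by subtracting multiples of the first, then drop it.
  eliminate : ∀ {d e p} (T : TriangularFamily (suc d) e (suc p)) l →
              ¬ TriangularFamily.vector T zero l ≈ 0# → TriangularFamily d e p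
  eliminate {d} {e} {p} T l pivot≉0 = record
    { vector   = λ j → removeAt (cleared j) l
    ; map      = map′
    ; linear   = λ i → IsLinear-∘ (linear (suc i)) (IsLinear-insertAt-0# l)
    ; lower    = λ i j j<i q → trans (map′-cleared i j q) (lower (suc i) (suc j) (s≤s j<i) q)
    ; diagonal = λ i map′ii≈0 → diagonal (suc i) (λ q → trans (sym (map′-cleared i i q)) (map′ii≈0 q))
    }
    where
    open TriangularFamily T
    pivot⁻¹ : Carrier
    pivot⁻¹ = proj₁ (inverse (vector zero l) pivot≉0)
    pivot*pivot⁻¹≈1 : vector zero l * pivot⁻¹ ≈ 1#
    pivot*pivot⁻¹≈1 = proj₂ (inverse (vector zero l) pivot≉0)
    cleared : Fin p → Vector K (suc d)
    cleared j = vector (suc j) -ᵥ (vector (suc j) l * pivot⁻¹) *ᵥ vector zero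
    cleared-l≈0 : ∀ j → cleared j l ≈ 0#
    cleared-l≈0 j = begin
      x - (x * pivot⁻¹) * vector zero l
        ≈⟨ +-congˡ (-‿cong (trans (*-assoc _ _ _) (trans (*-congˡ (trans (*-comm _ _) pivot*pivot⁻¹≈1)) (*-identityʳ x)))) ⟩
      x - x
        ≈⟨ -‿inverseʳ x ⟩
      0# ∎
      where
      x : Carrier
      x = vector (suc j) l
    map′ : Fin p → Vector K d → Vector K e
    map′ i w = map (suc i) (insertAt w l 0#)
    map′-cleared : ∀ i j → map′ i (removeAt (cleared j) l) ≈ᵥ map (suc i) (vector (suc j))
    map′-cleared i j q = trans
      (IsLinear.cong (linear (suc i)) (insertAt-removeAt-0# (cleared j) l (cleared-l≈0 j)) q)
      (IsLinear.homo-kernel (linear (suc i)) _ _ (lower (suc i) zero (s≤s z≤n)) q)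

  TriangularFamily⇒¬¬≤ : ∀ {d e p} → TriangularFamily d e p → ¬ ¬ (p ≤ d)
  TriangularFamily⇒¬¬≤ {d}     {p = zero}  T = ¬¬-intro z≤n
  TriangularFamily⇒¬¬≤ {zero}  {p = suc p} T = contradiction (λ ()) (vector₀≉0 T)
  TriangularFamily⇒¬¬≤ {suc d} {p = suc p} T = do
    (l , pivot≉0) ← ¬∀⇒¬¬∃¬ (suc d) (vector₀≉0 T)
    p≤d ← TriangularFamily⇒¬¬≤ (eliminate T l pivot≉0)
    ¬¬-intro (s≤s p≤d)

  -- Unitary OBDDs

  infixr 5 _▷_

  _▷_ : ∀ {d} → Matrix K d → Vector K d → Vector K d
  _▷_ = _·_ K

  _† : ∀ {d} → Matrix K d → Matrix K d
  (M †) i j = conj (M j i)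

  IsLinear-▷ : ∀ {d} (M : Matrix K d) → IsLinear (M ▷_)
  IsLinear-▷ {d} M = record
    { cong = λ u≈v i → Σ-cong d (λ j → *-congˡ (u≈v j))
    ; homo = λ u a v i → trans
        (Σ-cong d (λ j → solve 4 (λ m u a v → m :* (u :- a :* v) := m :* u :- a :* (m :* v)) refl (M i j) (u j) a (v j)))
        (Σ--* d _ _ a)
    }

  unitary⇒▷-▷† : ∀ {d} (M : Matrix K d) → IsUnitary K M → ∀ v → M ▷ M † ▷ v ≈ᵥ v
  unitary⇒▷-▷† {d} M (_ , MM†≈I) v i = begin
    Σ d (λ j → M i j * Σ d (λ l → conj (M l j) * v l))    ≈⟨ Σ-cong d (λ j → *-distribˡ-Σ d _ _) ⟩
    Σ d (λ j → Σ d (λ l → M i j * (conj (M l j) * v l)))  ≈⟨ Σ-comm d d _ ⟩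
    Σ d (λ l → Σ d (λ j → M i j * (conj (M l j) * v l)))  ≈⟨ Σ-cong d (λ l → trans (Σ-cong d (λ j → sym (*-assoc _ _ _))) (sym (*-distribʳ-Σ d _ _))) ⟩
    Σ d (λ l → Σ d (λ j → M i j * conj (M l j)) * v l)    ≈⟨ Σ-cong d (λ l → *-congʳ (MM†≈I i l)) ⟩
    Σ d (λ l → δ K i l * v l)                             ≈⟨ Σ-δ d i v ⟩
    v i                                                   ∎

  unitary⇒normSq-▷ : ∀ {d} (M : Matrix K d) → IsUnitary K M → ∀ v → normSq K (M ▷ v) ≈ normSq K v
  unitary⇒normSq-▷ {d} M (M†M≈I , _) v = begin
    Σ d (λ i → conj (Σ d (λ j → M i j * v j)) * Σ d (λ l → M i l * v l))
      ≈⟨ Σ-cong d (λ i → *-congʳ (trans (conj-Σ d _) (Σ-cong d (λ j → conj-* _ _)))) ⟩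
    Σ d (λ i → Σ d (λ j → conj (M i j) * conj (v j)) * Σ d (λ l → M i l * v l))
      ≈⟨ Σ-cong d (λ i → trans (*-distribʳ-Σ d _ _) (Σ-cong d (λ j → *-distribˡ-Σ d _ _))) ⟩
    Σ d (λ i → Σ d (λ j → Σ d (λ l → (conj (M i j) * conj (v j)) * (M i l * v l))))
      ≈⟨ trans (Σ-comm d d _) (Σ-cong d (λ j → Σ-comm d d _)) ⟩
    Σ d (λ j → Σ d (λ l → Σ d (λ i → (conj (M i j) * conj (v j)) * (M i l * v l))))
      ≈⟨ Σ-cong d (λ j → Σ-cong d (λ l → trans
           (Σ-cong d (λ i → solve 4 (λ a b x y → (a :* b) :* (x :* y) := (b :* y) :* (a :* x)) refl (conj (M i j)) (conj (v j)) (M i l) (v l)))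
           (sym (*-distribˡ-Σ d _ _)))) ⟩
    Σ d (λ j → Σ d (λ l → (conj (v j) * v l) * Σ d (λ i → conj (M i j) * M i l)))
      ≈⟨ Σ-cong d (λ j → Σ-cong d (λ l → trans (*-congˡ (M†M≈I j l)) (*-comm _ _))) ⟩
    Σ d (λ j → Σ d (λ l → δ K j l * (conj (v j) * v l)))
      ≈⟨ Σ-cong d (λ j → Σ-δ d j _) ⟩
    Σ d (λ j → conj (v j) * v j)
      ∎

  run : ∀ {n d} → (Fin n → Bool → Matrix K d) → (Fin n → Bool) → Vector K d → Vector K d
  run {zero}  U x ψ = ψ
  run {suc n} U x ψ = run (U ∘ suc) (x ∘ suc) (U zero (x zero) ▷ ψ)

  IsLinear-run : ∀ {n d} (U : Fin n → Bool → Matrix K d) x → IsLinear (run U x)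
  IsLinear-run {zero}  U x = record { cong = id ; homo = λ _ _ _ _ → refl }
  IsLinear-run {suc n} U x = IsLinear-∘ (IsLinear-run (U ∘ suc) (x ∘ suc)) (IsLinear-▷ (U zero (x zero)))

  run-cong : ∀ {n d} (U : Fin n → Bool → Matrix K d) {x y} → x ≗ y → ∀ ψ → run U x ψ ≡ run U y ψ
  run-cong {zero}  U x≗y ψ = ≡.refl
  run-cong {suc n} U x≗y ψ rewrite x≗y zero = run-cong (U ∘ suc) (x≗y ∘ suc) _

  run-∘ : ∀ {n d} (U : Fin n → Bool → Matrix K d) (f : Bool → Bool) x ψ → run (λ j → U j ∘ f) x ψ ≡ run U (f ∘ x) ψ
  run-∘ {zero}  U f x ψ = ≡.refl
  run-∘ {suc n} U f x ψ = run-∘ (U ∘ suc) f (x ∘ suc) _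

  -- The state after the first step is again a unit vector, so it is the initial state of a
  -- diagram for the remaining steps; this is how the definition of finalState is unfolded.
  finalState≡run : ∀ {n d} (B : UOBDD K n d) σ →
                   UOBDD.finalState B σ ≡ run (UOBDD.U B) (λ j → σ (UOBDD.order B ⟨$⟩ʳ j)) (UOBDD.ψ₀ B)
  finalState≡run {zero}      B σ = ≡.refl
  finalState≡run {suc n} {d} B σ = finalState≡run B′ (λ j → σ (order ⟨$⟩ʳ suc j))
    where
    open UOBDD B
    B′ : UOBDD K n d
    B′ = record
      { ψ₀        = U zero (σ (order ⟨$⟩ʳ zero)) ▷ ψ₀
      ; ψ₀-unit   = trans (unitary⇒normSq-▷ _ (U-unitary _ _) ψ₀) ψ₀-unit
      ; accepting = accepting
      ; order     = Perm.id
      ; U         = U ∘ suc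
      ; U-unitary = U-unitary ∘ suc
      }

  probe : ∀ {n d} → (Fin n → Bool → Matrix K d) → ℕ → Vector K d → Vector K d
  probe         U zero    ψ = ψ
  probe {zero}  U (suc m) ψ = ψ
  probe {suc n} U (suc m) ψ = U zero false † ▷ probe (U ∘ suc) m (U zero true ▷ ψ)

  run-interval-probe : ∀ {n d} (U : Fin n → Bool → Matrix K d) → (∀ j b → IsUnitary K (U j b)) →
                       ∀ ψ {m m′ k} → m ≤ m′ → m′ ≤ k → k ≤ n →
                       ∃ λ x → countOnes x ℕ.+ m′ ≡ m ℕ.+ k × run U (interval m′ k) (probe U m ψ) ≈ᵥ run U x ψ
  run-interval-probe U unitary ψ {zero} {m′} {k} _ m′≤k k≤n =
    interval m′ k , ≡.trans (≡.cong (ℕ._+ m′) (countOnes-interval m′ k m′≤k k≤n)) (ℕ.m∸n+n≡m m′≤k) , λ _ → refl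
  run-interval-probe {suc n} U unitary ψ {suc m} {suc m′} {suc k} (s≤s m≤m′) (s≤s m′≤k) (s≤s k≤n)
    with run-interval-probe (U ∘ suc) (unitary ∘ suc) (U zero true ▷ ψ) m≤m′ m′≤k k≤n
  ... | x , x-count , x-run = true ∷ x , count , λ q → trans (cancel q) (x-run q)
    where
    count : suc (countOnes x) ℕ.+ suc m′ ≡ suc m ℕ.+ suc k
    count = ≡.cong suc (≡.trans (ℕ.+-suc _ m′) (≡.trans (≡.cong suc x-count) (≡.sym (ℕ.+-suc m k))))
    cancel : run (U ∘ suc) (interval m′ k) (U zero false ▷ U zero false † ▷ probe (U ∘ suc) m (U zero true ▷ ψ))
             ≈ᵥ run (U ∘ suc) (interval m′ k) (probe (U ∘ suc) m (U zero true ▷ ψ))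
    cancel = IsLinear.cong (IsLinear-run (U ∘ suc) (interval m′ k)) (unitary⇒▷-▷† (U zero false) (unitary zero false) _)

  -- The probes tᵢ = probe U i ψ and the maps rᵢ = project acc ∘ run U (interval i k) form a
  -- triangular family: rᵢ tⱼ is the accepted part of the state after an input with k - i + j ones.
  acceptsExactly⇒¬¬k<d : ∀ {n d} (U : Fin n → Bool → Matrix K d) → (∀ j b → IsUnitary K (U j b)) →
                         ∀ ψ acc k → k ≤ n →
                         (∀ x → countOnes x ≡ k → ¬ project acc (run U x ψ) ≈ᵥ 0ᵥ) →
                         (∀ x → ¬ countOnes x ≡ k → ¬ ¬ project acc (run U x ψ) ≈ᵥ 0ᵥ) →
                         ¬ ¬ (k ℕ.< d)
  acceptsExactly⇒¬¬k<d {d = d} U unitary ψ acc k k≤n accept reject = do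
    lower ← ¬¬-Π (suc k) λ i → ¬¬-Π (suc k) λ j → ¬¬-→ (¬¬-lower i j)
    TriangularFamily⇒¬¬≤ (record
      { vector = vector ; map = map ; linear = linear ; lower = lower ; diagonal = diagonal })
    where
    vector : Fin (suc k) → Vector K d
    vector i = probe U (toℕ i) ψ
    map : Fin (suc k) → Vector K d → Vector K d
    map i = project acc ∘ run U (interval (toℕ i) k)
    linear : ∀ i → IsLinear (map i)
    linear i = IsLinear-∘ (IsLinear-project acc) (IsLinear-run U _)
    map-vector : ∀ i j → toℕ j ≤ toℕ i →
                 ∃ λ x → countOnes x ℕ.+ toℕ i ≡ toℕ j ℕ.+ k × map i (vector j) ≈ᵥ project acc (run U x ψ)
    map-vector i j j≤i with run-interval-probe U unitary ψ j≤i (Finₚ.toℕ≤pred[n] i) k≤n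
    ... | x , x-count , x-run = x , x-count , IsLinear.cong (IsLinear-project acc) x-run
    ¬¬-lower : ∀ i j → j Fin.< i → ¬ ¬ map i (vector j) ≈ᵥ 0ᵥ
    ¬¬-lower i j j<i with map-vector i j (ℕ.<⇒≤ j<i)
    ... | x , x-count , map-ij≈ = do
      x-rejected ← reject x x-count≢k
      ¬¬-intro λ q → trans (map-ij≈ q) (x-rejected q)
      where
      x-count≢k : ¬ countOnes x ≡ k
      x-count≢k x-count≡k = ℕ.<⇒≢ j<i (ℕ.+-cancelʳ-≡ k _ _
        (≡.trans (≡.sym x-count) (≡.trans (≡.cong (ℕ._+ toℕ i) x-count≡k) (ℕ.+-comm k (toℕ i)))))
    diagonal : ∀ i → ¬ map i (vector i) ≈ᵥ 0ᵥ
    diagonal i map-ii≈0 with map-vector i i ℕ.≤-refl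
    ... | x , x-count , map-ii≈ =
      accept x (ℕ.+-cancelʳ-≡ (toℕ i) _ _ (≡.trans x-count (ℕ.+-comm (toℕ i) k)))
        (λ q → trans (sym (map-ii≈ q)) (map-ii≈0 q))

  module _ {n d k} (B : UOBDD K n d) (computes : NComputes K B (EXACT n k)) where
    open UOBDD B

    -- An input x listed in reading order is the assignment x ∘ order⁻¹ of the variables.
    finalState-readingOrder : ∀ x → finalState (x ∘ (order ⟨$⟩ˡ_)) ≡ run U x ψ₀
    finalState-readingOrder x =
      ≡.trans (finalState≡run B (x ∘ (order ⟨$⟩ˡ_))) (run-cong U (λ _ → ≡.cong x (Perm.inverseˡ order)) ψ₀)

    accepts : ∀ x → countOnes x ≡ k → ¬ project accepting (run U x ψ₀) ≈ᵥ 0ᵥ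
    accepts x x-count≡k accepted≈0 = proj₁ (computes (x ∘ (order ⟨$⟩ˡ_)))
      (countOnes≡k⇒EXACT (x ∘ (order ⟨$⟩ˡ_)) (≡.trans (countOnes-permute order x) x-count≡k))
      (≡.subst (λ v → acceptanceWeight accepting v ≈ 0#) (≡.sym (finalState-readingOrder x))
        (project≈0⇒acceptanceWeight≈0 accepting _ accepted≈0))

    rejects : ∀ x → ¬ countOnes x ≡ k → ¬ ¬ project accepting (run U x ψ₀) ≈ᵥ 0ᵥ
    rejects x x-count≢k = do
      weight≈0 ← λ weight≉0 → x-count≢k (≡.trans (≡.sym (countOnes-permute order x))
        (EXACT⇒countOnes≡k (x ∘ (order ⟨$⟩ˡ_)) (proj₂ (computes (x ∘ (order ⟨$⟩ˡ_))) weight≉0)))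
      ≡.subst (λ v → ¬ ¬ project accepting v ≈ᵥ 0ᵥ) (finalState-readingOrder x)
        (acceptanceWeight≈0⇒¬¬project≈0 accepting _ weight≈0)

    ¬¬k<d : k ≤ n → ¬ ¬ (k ℕ.< d)
    ¬¬k<d k≤n = acceptsExactly⇒¬¬k<d U U-unitary ψ₀ accepting k k≤n accepts rejects

    -- Flipping every input bit gives a diagram accepting exactly the inputs with n - k ones.
    ¬¬n-k<d : k ≤ n → ¬ ¬ (n ℕ.∸ k ℕ.< d)
    ¬¬n-k<d k≤n = acceptsExactly⇒¬¬k<d (λ j → U j ∘ not) (λ j → U-unitary j ∘ not) ψ₀ accepting
      (n ℕ.∸ k) (ℕ.m∸n≤m n k)
      (λ x → ≡.subst (λ v → ¬ project accepting v ≈ᵥ 0ᵥ) (≡.sym (run-∘ U not x ψ₀))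
               ∘ accepts (not ∘ x) ∘ countOnes≡n∸k⇒countOnes-not≡k x k≤n)
      (λ x → ≡.subst (λ v → ¬ ¬ project accepting v ≈ᵥ 0ᵥ) (≡.sym (run-∘ U not x ψ₀))
               ∘ rejects (not ∘ x) ∘ contraposition (countOnes-not≡k⇒countOnes≡n∸k x))

open import Data.Nat using (ℕ; _≤_; _+_; _∸_; _⊔_)

theorem5 : ∀ {c ℓ} (K : ConjField c ℓ) (n k d : ℕ) → 1 ≤ n → k ≤ n →
           (B : UOBDD K n d) → NComputes K B (EXACT n k) →
           (k + 1) ⊔ (n ∸ k + 1) ≤ d
theorem5 K n k d _ k≤n B computes = ℕ.⊔-lub
  (≡.subst (_≤ d) (ℕ.+-comm 1 k) (decidable-stable (_ ℕ.≤? d) (¬¬k<d K B computes k≤n)))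
  (≡.subst (_≤ d) (ℕ.+-comm 1 (n ∸ k)) (decidable-stable (_ ℕ.≤? d) (¬¬n-k<d K B computes k≤n)))
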